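{- Let $A$ be a symmetric (respectively anti-symmetric) integer weighing matrix and let $M$ be a monomial matrix with $(M^\top,M)\in\mathrm{Aut}(A)$, so that $MA$ is symmetric (respectively anti-symmetric). Then $MA$ is SH-equivalent to $A$ if and only if there exists $(P,Q)\in\mathrm{Aut}(A)$ with $Q^\top P=M$.
   Context: An integer weighing matrix is $A\in\mathbb Z^{n\times n}$ with $AA^\top=kI$. Monomial matrices are $n\times n$ matrices with entries in $\{0,\pm1\}$ having exactly one nonzero entry in each row and column. $\mathrm{Aut}(A)=\{(L,R)\text{ monomial}:LAR^\top=A\}$. Two matrices $B,C$ are SH-equivalent if $C=TBT^\top$ for some monomial $T$. -}

module Defs where

open import Data.Nat using (ℕ; zero; suc)
open import Data.Fin using (Fin; zero; suc; _≟_)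
open import Relation.Nullary using (yes; no)
open import Data.Integer using (ℤ; _+_; _*_; -_; 0ℤ; 1ℤ; -1ℤ)
open import Data.Product using (Σ; _×_; _,_)
open import Data.Sum using (_⊎_)
open import Relation.Binary.PropositionalEquality using (_≡_; _≢_)

Mat : ℕ → Set
Mat n = Fin n → Fin n → ℤ

Σ[<_]_ : (n : ℕ) → (Fin n → ℤ) → ℤ
Σ[< zero ] f = 0ℤ
Σ[< suc n ] f = f zero + Σ[< n ] (λ i → f (suc i))

infixl 7 _·_
_·_ : ∀ {n} → Mat n → Mat n → Mat n
(A · B) i j = Σ[< _ ] (λ l → A i l * B l j)

_ᵀ : ∀ {n} → Mat n → Mat n
(A ᵀ) i j = A j i

scalarI : ∀ {n} → ℤ → Mat n
scalarI k i j with i ≟ j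
... | yes _ = k
... | no _ = 0ℤ

infix 4 _≈_
_≈_ : ∀ {n} → Mat n → Mat n → Set
A ≈ B = ∀ i j → A i j ≡ B i j

Symmetric : ∀ {n} → Mat n → Set
Symmetric A = A ᵀ ≈ A

AntiSymmetric : ∀ {n} → Mat n → Set
AntiSymmetric A = A ᵀ ≈ (λ i j → - A i j)

IsWeighing : ∀ {n} → ℤ → Mat n → Set
IsWeighing k A = A · A ᵀ ≈ scalarI k

IsMonomial : ∀ {n} → Mat n → Set
IsMonomial {n} M =
  (∀ i j → (M i j ≡ 0ℤ) ⊎ (M i j ≡ 1ℤ) ⊎ (M i j ≡ -1ℤ))
  × (∀ i → Σ (Fin n) λ j → (M i j ≢ 0ℤ) × (∀ j′ → M i j′ ≢ 0ℤ → j′ ≡ j))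
  × (∀ j → Σ (Fin n) λ i → (M i j ≢ 0ℤ) × (∀ i′ → M i′ j ≢ 0ℤ → i′ ≡ i))

InAut : ∀ {n} → Mat n → Mat n → Mat n → Set
InAut A L R = IsMonomial L × IsMonomial R × (L · A · R ᵀ ≈ A)

SHEquiv : ∀ {n} → Mat n → Mat n → Set
SHEquiv {n} B C = Σ (Mat n) λ T → IsMonomial T × (C ≈ T · B · T ᵀ)

{-# OPTIONS --safe #-}
-- Monomial matrices are orthogonal, so for monomial Q the condition Qᵀ P = M
-- says exactly that P = Q M.  Then P A Qᵀ = Q (M A) Qᵀ, and (P , Q) ∈ Aut(A)
-- says precisely that Q conjugates M A to A; conversely a conjugating T gives
-- (T M , T) ∈ Aut(A).
module Submission where

open import Defs
open import Data.Nat.Base using (ℕ; zero; suc)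
open import Data.Fin.Base using (Fin; zero; suc)
open import Data.Fin.Properties using (_≟_; punchInᵢ≢i)
open import Data.Integer.Base using (ℤ; _+_; _*_; 0ℤ; 1ℤ; -1ℤ)
open import Data.Integer.Properties
  using (+-*-semiring; +-identityʳ; *-identityˡ; *-zeroʳ; *-comm; *-assoc; i*j≡0⇒i≡0∨j≡0)
  renaming (_≟_ to _≟ℤ_)
open import Algebra.Properties.Semiring.Sum +-*-semiring
  using (sum; sum-cong-≗; sum-remove; sum-replicate-zero; ∑-comm; *-distribˡ-sum; *-distribʳ-sum)
open import Data.Vec.Functional using (removeAt)
open import Data.Product using (Σ; _×_; _,_; proj₁; proj₂)
open import Data.Sum using (_⊎_; inj₁; inj₂; [_,_]′)
open import Function.Base using (_∘_)
open import Function.Bundles using (_⇔_; mk⇔; Equivalence)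
open import Relation.Nullary using (Dec; yes; no; contradiction)
open import Relation.Nullary.Decidable using (decidable-stable)
open import Relation.Binary.Bundles using (Setoid)
open import Relation.Binary.PropositionalEquality
  using (_≡_; _≢_; _≗_; refl; sym; trans; cong; cong₂; subst; module ≡-Reasoning)
import Relation.Binary.Reasoning.Setoid as SetoidReasoning

private
  variable
    n : ℕ
    i j : Fin n
    a b : ℤ
    A B C M P Q X Y : Mat n

Σ[<]≡sum : (f : Fin n → ℤ) → Σ[< n ] f ≡ sum f
Σ[<]≡sum {zero}  f = refl
Σ[<]≡sum {suc n} f = cong (f zero +_) (Σ[<]≡sum (f ∘ suc))

Σ[<]-cong : {f g : Fin n → ℤ} → f ≗ g → Σ[< n ] f ≡ Σ[< n ] g
Σ[<]-cong {f = f} {g} f≗g =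
  trans (Σ[<]≡sum f) (trans (sum-cong-≗ f≗g) (sym (Σ[<]≡sum g)))

Σ[<]-single : (f : Fin n → ℤ) (c : Fin n) → (∀ l → l ≢ c → f l ≡ 0ℤ) →
              Σ[< n ] f ≡ f c
Σ[<]-single {zero}  f () _
Σ[<]-single {suc n} f c vanishes = begin
  Σ[< suc n ] f             ≡⟨ Σ[<]≡sum f ⟩
  sum f                     ≡⟨ sum-remove {i = c} f ⟩
  f c + sum (removeAt f c)  ≡⟨ cong (f c +_) sum-rest≡0 ⟩
  f c + 0ℤ                  ≡⟨ +-identityʳ (f c) ⟩
  f c                       ∎
  where
  open ≡-Reasoning
  sum-rest≡0 : sum (removeAt f c) ≡ 0ℤ
  sum-rest≡0 = trans (sum-cong-≗ (λ l → vanishes _ (punchInᵢ≢i c l)))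
                     (sum-replicate-zero n)

≈-refl : A ≈ A
≈-refl _ _ = refl

≈-sym : A ≈ B → B ≈ A
≈-sym A≈B i j = sym (A≈B i j)

≈-trans : A ≈ B → B ≈ C → A ≈ C
≈-trans A≈B B≈C i j = trans (A≈B i j) (B≈C i j)

≈-setoid : ℕ → Setoid _ _
≈-setoid n = record
  { Carrier       = Mat n
  ; _≈_           = _≈_
  ; isEquivalence = record { refl = ≈-refl ; sym = ≈-sym ; trans = ≈-trans }
  }

·≡sum : (A B : Mat n) (i j : Fin n) → (A · B) i j ≡ sum (λ l → A i l * B l j)
·≡sum A B i j = Σ[<]≡sum (λ l → A i l * B l j)

·-cong : A ≈ B → X ≈ Y → A · X ≈ B · Y
·-cong A≈B X≈Y i j = Σ[<]-cong (λ l → cong₂ _*_ (A≈B i l) (X≈Y l j))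

·-congˡ : X ≈ Y → A · X ≈ A · Y
·-congˡ {A = A} = ·-cong {A = A} ≈-refl

·-congʳ : A ≈ B → A · X ≈ B · X
·-congʳ A≈B = ·-cong A≈B ≈-refl

·-assoc : (A B C : Mat n) → (A · B) · C ≈ A · (B · C)
·-assoc A B C i j = begin
  ((A · B) · C) i j
    ≡⟨ ·≡sum (A · B) C i j ⟩
  sum (λ m → (A · B) i m * C m j)
    ≡⟨ sum-cong-≗ (λ m → cong (_* C m j) (·≡sum A B i m)) ⟩
  sum (λ m → sum (λ l → A i l * B l m) * C m j)
    ≡⟨ sum-cong-≗ (λ m → *-distribʳ-sum (C m j) (λ l → A i l * B l m)) ⟩
  sum (λ m → sum (λ l → A i l * B l m * C m j))
    ≡⟨ ∑-comm (λ m l → A i l * B l m * C m j) ⟩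
  sum (λ l → sum (λ m → A i l * B l m * C m j))
    ≡⟨ sum-cong-≗ (λ l → sum-cong-≗ (λ m → *-assoc (A i l) (B l m) (C m j))) ⟩
  sum (λ l → sum (λ m → A i l * (B l m * C m j)))
    ≡⟨ sum-cong-≗ (λ l → *-distribˡ-sum (A i l) (λ m → B l m * C m j)) ⟨
  sum (λ l → A i l * sum (λ m → B l m * C m j))
    ≡⟨ sum-cong-≗ (λ l → cong (A i l *_) (·≡sum B C l j)) ⟨
  sum (λ l → A i l * (B · C) l j)
    ≡⟨ ·≡sum A (B · C) i j ⟨
  (A · (B · C)) i j
    ∎
  where open ≡-Reasoning

·-ᵀ : (A B : Mat n) → (A · B) ᵀ ≈ B ᵀ · A ᵀ
·-ᵀ A B i j = Σ[<]-cong (λ l → *-comm (A j l) (B l i))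

·-rowSupported : ∀ {c} (A B : Mat n) (i j : Fin n) → (∀ l → l ≢ c → A i l ≡ 0ℤ) →
                 (A · B) i j ≡ A i c * B c j
·-rowSupported {c = c} A B i j vanishes =
  Σ[<]-single (λ l → A i l * B l j) c (λ l l≢c → cong (_* B l j) (vanishes l l≢c))

scalarI-diag : (k : ℤ) (i : Fin n) → scalarI k i i ≡ k
scalarI-diag k i with i ≟ i
... | yes _   = refl
... | no i≢i = contradiction refl i≢i

scalarI-offDiag : (k : ℤ) → i ≢ j → scalarI k i j ≡ 0ℤ
scalarI-offDiag {i = i} {j} k i≢j with i ≟ j
... | yes i≡j = contradiction i≡j i≢j
... | no _    = refl

·-identityˡ : (A : Mat n) → scalarI 1ℤ · A ≈ A
·-identityˡ A i j = begin
  (scalarI 1ℤ · A) i j     ≡⟨ ·-rowSupported (scalarI 1ℤ) A i j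
                                (λ l l≢i → scalarI-offDiag 1ℤ (l≢i ∘ sym)) ⟩
  scalarI 1ℤ i i * A i j   ≡⟨ cong (_* A i j) (scalarI-diag 1ℤ i) ⟩
  1ℤ * A i j               ≡⟨ *-identityˡ (A i j) ⟩
  A i j                    ∎
  where open ≡-Reasoning

·-cancelˡ : X · Y ≈ scalarI 1ℤ → X · (Y · B) ≈ B
·-cancelˡ {X = X} {Y} {B = B} XY≈I = begin
  X · (Y · B)     ≈⟨ ·-assoc X Y B ⟨
  (X · Y) · B     ≈⟨ ·-congʳ XY≈I ⟩
  scalarI 1ℤ · B  ≈⟨ ·-identityˡ B ⟩
  B               ∎
  where open SetoidReasoning (≈-setoid _)

SignOrZero : ℤ → Set
SignOrZero a = (a ≡ 0ℤ) ⊎ (a ≡ 1ℤ) ⊎ (a ≡ -1ℤ)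

OneNonzeroPerRow : Mat n → Set
OneNonzeroPerRow {n} M = ∀ i → Σ (Fin n) λ j → (M i j ≢ 0ℤ) × (∀ j′ → M i j′ ≢ 0ℤ → j′ ≡ j)

*-signOrZero : SignOrZero a → SignOrZero b → SignOrZero (a * b)
*-signOrZero (inj₁ refl)        _                  = inj₁ refl
*-signOrZero (inj₂ (inj₁ refl)) (inj₁ refl)        = inj₁ refl
*-signOrZero (inj₂ (inj₁ refl)) (inj₂ (inj₁ refl)) = inj₂ (inj₁ refl)
*-signOrZero (inj₂ (inj₁ refl)) (inj₂ (inj₂ refl)) = inj₂ (inj₂ refl)
*-signOrZero (inj₂ (inj₂ refl)) (inj₁ refl)        = inj₁ refl
*-signOrZero (inj₂ (inj₂ refl)) (inj₂ (inj₁ refl)) = inj₂ (inj₂ refl)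
*-signOrZero (inj₂ (inj₂ refl)) (inj₂ (inj₂ refl)) = inj₂ (inj₁ refl)

signOrZero-square : SignOrZero a → a ≢ 0ℤ → a * a ≡ 1ℤ
signOrZero-square (inj₁ refl)        a≢0 = contradiction refl a≢0
signOrZero-square (inj₂ (inj₁ refl)) _   = refl
signOrZero-square (inj₂ (inj₂ refl)) _   = refl

*-≢0 : a ≢ 0ℤ → b ≢ 0ℤ → a * b ≢ 0ℤ
*-≢0 {a} a≢0 b≢0 = [ a≢0 , b≢0 ]′ ∘ i*j≡0⇒i≡0∨j≡0 a

*-≢0⇒≢0ʳ : ∀ a → a * b ≢ 0ℤ → b ≢ 0ℤ
*-≢0⇒≢0ʳ a ab≢0 refl = ab≢0 (*-zeroʳ a)

zero-off-unique-nonzero : ∀ {c} (f : Fin n → ℤ) → (∀ j → f j ≢ 0ℤ → j ≡ c) →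
                          ∀ l → l ≢ c → f l ≡ 0ℤ
zero-off-unique-nonzero f unique l l≢c = decidable-stable (f l ≟ℤ 0ℤ) (l≢c ∘ unique l)

·-pivot : (rows : OneNonzeroPerRow A) (B : Mat n) (j : Fin n) → let c = proj₁ (rows i) in
          (A · B) i j ≡ A i c * B c j
·-pivot {A = A} {i = i} rows B j =
  ·-rowSupported A B i j (zero-off-unique-nonzero (A i) (proj₂ (proj₂ (rows i))))

oneNonzeroPerRow-resp-≈ : A ≈ B → OneNonzeroPerRow A → OneNonzeroPerRow B
oneNonzeroPerRow-resp-≈ A≈B rows i with rows i
... | j , Aij≢0 , unique =
  j , Aij≢0 ∘ trans (A≈B i j) , λ j′ Bij′≢0 → unique j′ (Bij′≢0 ∘ trans (sym (A≈B i j′)))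

oneNonzeroPerRow-· : OneNonzeroPerRow A → OneNonzeroPerRow B → OneNonzeroPerRow (A · B)
oneNonzeroPerRow-· {A = A} {B = B} rowsA rowsB i =
  μ , subst (_≢ 0ℤ) (sym (pivot μ)) (*-≢0 Aic≢0 Bcμ≢0) ,
  λ j′ ABij′≢0 → uniqueB j′ (*-≢0⇒≢0ʳ (A i c) (subst (_≢ 0ℤ) (pivot j′) ABij′≢0))
  where
  c : Fin _
  c = proj₁ (rowsA i)
  Aic≢0 : A i c ≢ 0ℤ
  Aic≢0 = proj₁ (proj₂ (rowsA i))
  pivot : ∀ j → (A · B) i j ≡ A i c * B c j
  pivot = ·-pivot rowsA B
  μ : Fin _
  μ = proj₁ (rowsB c)
  Bcμ≢0 : B c μ ≢ 0ℤ
  Bcμ≢0 = proj₁ (proj₂ (rowsB c))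
  uniqueB : ∀ j′ → B c j′ ≢ 0ℤ → j′ ≡ μ
  uniqueB = proj₂ (proj₂ (rowsB c))

monomial-ᵀ : IsMonomial A → IsMonomial (A ᵀ)
monomial-ᵀ (entries , rows , cols) = (λ i j → entries j i) , cols , rows

monomial-· : IsMonomial A → IsMonomial B → IsMonomial (A · B)
monomial-· {A = A} {B = B} (entriesA , rowsA , colsA) (entriesB , rowsB , colsB) =
  entries , oneNonzeroPerRow-· rowsA rowsB ,
  oneNonzeroPerRow-resp-≈ (≈-sym (·-ᵀ A B)) (oneNonzeroPerRow-· colsB colsA)
  where
  entries : ∀ i j → SignOrZero ((A · B) i j)
  entries i j = subst SignOrZero (sym (·-pivot {i = i} rowsA B j))
                      (*-signOrZero (entriesA i _) (entriesB _ j))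

monomial-·ᵀ : IsMonomial Q → Q · Q ᵀ ≈ scalarI 1ℤ
monomial-·ᵀ {Q = Q} (entries , rows , cols) i j =
  trans (·-pivot rows (Q ᵀ) j) (pivot-product (i ≟ j))
  where
  c : Fin _
  c = proj₁ (rows i)
  Qic≢0 : Q i c ≢ 0ℤ
  Qic≢0 = proj₁ (proj₂ (rows i))
  uniqueᶜ : ∀ r → Q r c ≢ 0ℤ → r ≡ proj₁ (cols c)
  uniqueᶜ = proj₂ (proj₂ (cols c))
  pivot-product : Dec (i ≡ j) → Q i c * Q j c ≡ scalarI 1ℤ i j
  pivot-product (yes refl) = begin
    Q i c * Q i c   ≡⟨ signOrZero-square (entries i c) Qic≢0 ⟩
    1ℤ              ≡⟨ scalarI-diag 1ℤ i ⟨
    scalarI 1ℤ i i  ∎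
    where open ≡-Reasoning
  pivot-product (no i≢j) = begin
    Q i c * Q j c   ≡⟨ cong (Q i c *_) Qjc≡0 ⟩
    Q i c * 0ℤ      ≡⟨ *-zeroʳ (Q i c) ⟩
    0ℤ              ≡⟨ scalarI-offDiag 1ℤ i≢j ⟨
    scalarI 1ℤ i j  ∎
    where
    open ≡-Reasoning
    Qjc≡0 : Q j c ≡ 0ℤ
    Qjc≡0 = zero-off-unique-nonzero (λ r → Q r c) uniqueᶜ j
              (λ j≡r → i≢j (trans (uniqueᶜ i Qic≢0) (sym j≡r)))

monomial-ᵀ· : IsMonomial Q → Q ᵀ · Q ≈ scalarI 1ℤ
monomial-ᵀ· = monomial-·ᵀ ∘ monomial-ᵀ

monomial-ᵀ·≈⇔·≈ : IsMonomial Q → (Q ᵀ · P ≈ M ⇔ Q · M ≈ P)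
monomial-ᵀ·≈⇔·≈ {Q = Q} {P = P} {M = M} monQ = mk⇔
  (λ QᵀP≈M → ≈-trans (·-congˡ {A = Q} (≈-sym QᵀP≈M))
                      (·-cancelˡ {X = Q} {Q ᵀ} {B = P} (monomial-·ᵀ monQ)))
  (λ QM≈P → ≈-trans (·-congˡ {A = Q ᵀ} (≈-sym QM≈P))
                    (·-cancelˡ {X = Q ᵀ} {Q} {B = M} (monomial-ᵀ· monQ)))

conjugate-·-reassoc : (T M A : Mat n) → T · (M · A) · T ᵀ ≈ (T · M) · A · T ᵀ
conjugate-·-reassoc T M A = ·-congʳ (≈-sym (·-assoc T M A))

lemma5p7 : (n : ℕ) (k : ℤ) (A M : Mat n) →
    IsWeighing k A → (Symmetric A ⊎ AntiSymmetric A) →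
    IsMonomial M → InAut A (M ᵀ) M →
    (SHEquiv (M · A) A ⇔ Σ (Mat n) λ P → Σ (Mat n) λ Q → InAut A P Q × (Q ᵀ · P ≈ M))
lemma5p7 n _ A M _ _ monM _ = mk⇔ autFromSH shFromAut
  where
  open SetoidReasoning (≈-setoid n)

  autFromSH : SHEquiv (M · A) A →
              Σ (Mat n) λ P → Σ (Mat n) λ Q → InAut A P Q × (Q ᵀ · P ≈ M)
  autFromSH (T , monT , A≈T[MA]Tᵀ) =
    T · M , T ,
    (monomial-· monT monM , monT ,
     ≈-sym (≈-trans A≈T[MA]Tᵀ (conjugate-·-reassoc T M A))) ,
    Equivalence.from (monomial-ᵀ·≈⇔·≈ monT) ≈-refl

  shFromAut : (Σ (Mat n) λ P → Σ (Mat n) λ Q → InAut A P Q × (Q ᵀ · P ≈ M)) →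
              SHEquiv (M · A) A
  shFromAut (P , Q , (_ , monQ , PAQᵀ≈A) , QᵀP≈M) = Q , monQ , ≈-sym (begin
    Q · (M · A) · Q ᵀ  ≈⟨ conjugate-·-reassoc Q M A ⟩
    (Q · M) · A · Q ᵀ  ≈⟨ ·-congʳ (·-congʳ (Equivalence.to (monomial-ᵀ·≈⇔·≈ monQ) QᵀP≈M)) ⟩
    P · A · Q ᵀ        ≈⟨ PAQᵀ≈A ⟩
    A                  ∎)
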